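{- Let $V\in M_{r\times t}(\mathbb{Z})$ be a matrix of complexity one with no zero columns and $t\ge3$, and let $\psi:\mathbb{Z}^d\twoheadrightarrow\mathbb{Z}^t\cap\ker(V)$ be a system of linear forms in $1$-normal form. Then $\psi$ is in exact $1$-normal form at every $i\in[t]$.
   Context: For a system of linear forms $\psi=(\psi_1,\dots,\psi_t)$ (over $\mathbb{Q}$) and $i\in[t]$, the complexity at $i$ is the least $s\ge0$ such that $[t]\setminus\{i\}$ can be partitioned into $s+1$ non-empty sets $X_1,\dots,X_{s+1}$ with $\psi_i\notin\langle\psi_j:j\in X_k\rangle$ for all $k$ ($\infty$ if none exists); the complexity of $\psi$ is the maximum over $i$, and the complexity of $V$ is that of any linear surjection $\mathbb{Q}^{d'}\twoheadrightarrow\ker_{\mathbb{Q}}(V)$. A linear form $\theta(x)=a_1x_1+\dots+a_dx_d$ depends on $x_k$ if $a_k\ne0$. A system $\psi:\mathbb{Z}^d\to\mathbb{Z}^t$ is in exact $s$-normal form at $i$ if there is $J\subset[d]$ with $|J|=s+1$ such that $\psi_i$ depends on all variables $x_k$, $k\in J$, and for every $j\ne i$, $\psi_j$ does not depend on all of the variables $x_k$, $k\in J$. It is in $s$-normal form if at every $i$ it is in exact $s_i$-normal form for some $s_i\le s$. -}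

module Defs where

open import Data.Nat using (ℕ; zero; suc; _≤_; _<_)
open import Data.Fin using (Fin)
import Data.Fin as F
open import Data.Integer as ℤ using (ℤ)
open import Data.Rational as ℚ using (ℚ; 0ℚ)
open import Data.Product using (Σ; ∃; _×_)
open import Relation.Binary.PropositionalEquality using (_≡_; _≢_)
open import Relation.Nullary using (¬_)
open import Function using (_∘_)
open import Function.Definitions using (Injective)

sumℤ : ∀ {n} → (Fin n → ℤ) → ℤ
sumℤ {zero}  f = ℤ.0ℤ
sumℤ {suc n} f = f F.zero ℤ.+ sumℤ (f ∘ F.suc)

sumℚ : ∀ {n} → (Fin n → ℚ) → ℚ
sumℚ {zero}  f = 0ℚ
sumℚ {suc n} f = f F.zero ℚ.+ sumℚ (f ∘ F.suc)

toℚ : ℤ → ℚ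
toℚ z = z ℚ./ 1

-- A system of t linear forms in d variables with coefficients in A:
-- row j is the coefficient vector of the form ψ_j.
Forms : Set → ℕ → ℕ → Set
Forms A t d = Fin t → Fin d → A

Matℤ : ℕ → ℕ → Set
Matℤ r t = Fin r → Fin t → ℤ

InSpan : ∀ {t d} → Forms ℚ t d → (Fin t → Set) → (Fin d → ℚ) → Set
InSpan {t} {d} ψ P v =
  Σ (Fin t → ℚ) λ c → (∀ j → ¬ P j → c j ≡ 0ℚ) ×
                      (∀ m → v m ≡ sumℚ (λ j → c j ℚ.* ψ j m))

-- [t] ∖ {i} can be partitioned into s+1 non-empty sets X_1..X_{s+1}
-- (block of j ≠ i given by f j; the value f i is irrelevant)
-- with ψ_i ∉ ⟨ψ_j : j ∈ X_k⟩ for every k.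
HasPartition : ∀ {t d} → Forms ℚ t d → Fin t → ℕ → Set
HasPartition {t} ψ i s =
  Σ (Fin t → Fin (suc s)) λ f →
    (∀ k → ∃ λ j → j ≢ i × f j ≡ k) ×
    (∀ k → ¬ InSpan ψ (λ j → j ≢ i × f j ≡ k) (ψ i))

ComplexityAtMostOneAt : ∀ {t d} → Forms ℚ t d → Fin t → Set
ComplexityAtMostOneAt ψ i = ∃ λ s → s ≤ 1 × HasPartition ψ i s

ComplexityExactlyOneAt : ∀ {t d} → Forms ℚ t d → Fin t → Set
ComplexityExactlyOneAt ψ i = HasPartition ψ i 1 × ¬ HasPartition ψ i 0

-- complexity of ψ (max over i) equals 1
ComplexityOne : ∀ {t d} → Forms ℚ t d → Set
ComplexityOne ψ = (∀ i → ComplexityAtMostOneAt ψ i) × ∃ (ComplexityExactlyOneAt ψ)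

InKerℚ : ∀ {r t} → Matℤ r t → (Fin t → ℚ) → Set
InKerℚ V y = ∀ a → sumℚ (λ j → toℚ (V a j) ℚ.* y j) ≡ 0ℚ

evalℚ : ∀ {t d} → Forms ℚ t d → (Fin d → ℚ) → Fin t → ℚ
evalℚ φ x j = sumℚ (λ k → φ j k ℚ.* x k)

IsSurjOntoKerℚ : ∀ {r t d'} → Matℤ r t → Forms ℚ t d' → Set
IsSurjOntoKerℚ V φ =
  (∀ x → InKerℚ V (evalℚ φ x)) ×
  (∀ y → InKerℚ V y → ∃ λ x → ∀ j → evalℚ φ x j ≡ y j)

-- V has complexity one: the complexity of a linear surjection
-- ℚ^{d'} ↠ ker_ℚ(V) is one (independent of the choice of surjection)
VComplexityOne : ∀ {r t} → Matℤ r t → Set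
VComplexityOne {r} {t} V =
  Σ ℕ λ d' → Σ (Forms ℚ t d') λ φ → IsSurjOntoKerℚ V φ × ComplexityOne φ

NoZeroColumns : ∀ {r t} → Matℤ r t → Set
NoZeroColumns V = ∀ j → ¬ (∀ a → V a j ≡ ℤ.0ℤ)

evalℤ : ∀ {t d} → Forms ℤ t d → (Fin d → ℤ) → Fin t → ℤ
evalℤ ψ x j = sumℤ (λ k → ψ j k ℤ.* x k)

InKerℤ : ∀ {r t} → Matℤ r t → (Fin t → ℤ) → Set
InKerℤ V y = ∀ a → sumℤ (λ j → V a j ℤ.* y j) ≡ ℤ.0ℤ

IsSurjOntoKerℤ : ∀ {r t d} → Matℤ r t → Forms ℤ t d → Set
IsSurjOntoKerℤ V ψ =
  (∀ x → InKerℤ V (evalℤ ψ x)) ×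
  (∀ y → InKerℤ V y → ∃ λ x → ∀ j → evalℤ ψ x j ≡ y j)

DependsOn : ∀ {t d} → Forms ℤ t d → Fin t → Fin d → Set
DependsOn ψ j k = ψ j k ≢ ℤ.0ℤ

-- exact s-normal form at i: J ⊆ [d] with |J| = s+1 (an injection Fin (s+1) → Fin d)
ExactNormalFormAt : ∀ {t d} → Forms ℤ t d → Fin t → ℕ → Set
ExactNormalFormAt {t} {d} ψ i s =
  Σ (Fin (suc s) → Fin d) λ J → Injective _≡_ _≡_ J ×
    (∀ a → DependsOn ψ i (J a)) ×
    (∀ j → j ≢ i → ¬ (∀ a → DependsOn ψ j (J a)))

NormalForm : ∀ {t d} → Forms ℤ t d → ℕ → Set
NormalForm ψ s = ∀ i → ∃ λ sᵢ → sᵢ ≤ s × ExactNormalFormAt ψ i sᵢ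

-- If ψ were in exact 0-normal form at i, some variable x_k would occur in ψ_i
-- and in no other form. Evaluating ψ at the k-th unit vector then gives a vector
-- of ker(V) supported exactly on coordinate i, which forces column i of V to
-- vanish. So the exact normal form at every i has level 1.
module Submission where

open import Defs
open import Data.Nat using (_≥_; zero; suc; s≤s)
open import Data.Fin using (Fin; _≟_)
import Data.Fin as F
open import Data.Fin.Properties using (suc-injective)
open import Data.Integer using (ℤ; 0ℤ; 1ℤ; _*_)
import Data.Integer as ℤ
open import Data.Integer.Properties
  using (*-zeroʳ; *-identityʳ; +-identityˡ; +-identityʳ; i*j≡0⇒i≡0∨j≡0)
open import Data.Product using (∃; _×_; _,_)
open import Data.Sum using (inj₁; inj₂)
open import Data.Empty using (⊥-elim)
open import Relation.Nullary using (¬_; yes; no)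
open import Relation.Binary.PropositionalEquality
open import Function using (_∘_)

sumℤ-zero : ∀ {n} (f : Fin n → ℤ) → (∀ j → f j ≡ 0ℤ) → sumℤ f ≡ 0ℤ
sumℤ-zero {zero}  f f≡0 = refl
sumℤ-zero {suc n} f f≡0
  rewrite f≡0 F.zero | sumℤ-zero (f ∘ F.suc) (f≡0 ∘ F.suc) = refl

sumℤ-single : ∀ {n} (f : Fin n → ℤ) (i : Fin n) →
              (∀ j → j ≢ i → f j ≡ 0ℤ) → sumℤ f ≡ f i
sumℤ-single {suc n} f F.zero f≡0
  rewrite sumℤ-zero (f ∘ F.suc) (λ j → f≡0 (F.suc j) (λ ())) = +-identityʳ (f F.zero)
sumℤ-single {suc n} f (F.suc i) f≡0
  rewrite f≡0 F.zero (λ ()) =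
    trans (+-identityˡ _)
          (sumℤ-single (f ∘ F.suc) i (λ j j≢i → f≡0 (F.suc j) (j≢i ∘ suc-injective)))

unit : ∀ {d} → Fin d → Fin d → ℤ
unit k m with m ≟ k
... | yes _ = 1ℤ
... | no  _ = 0ℤ

evalℤ-unit : ∀ {t d} (ψ : Forms ℤ t d) (k : Fin d) (j : Fin t) →
             evalℤ ψ (unit k) j ≡ ψ j k
evalℤ-unit ψ k j = trans (sumℤ-single _ k off-k) at-k
  where
  off-k : ∀ m → m ≢ k → ψ j m * unit k m ≡ 0ℤ
  off-k m m≢k with m ≟ k
  ... | yes m≡k = ⊥-elim (m≢k m≡k)
  ... | no  _   = *-zeroʳ (ψ j m)
  at-k : ψ j k * unit k k ≡ ψ j k
  at-k with k ≟ k
  ... | yes _   = *-identityʳ (ψ j k)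
  ... | no  k≢k = ⊥-elim (k≢k refl)

exactNormalForm₀⇒privateVariable :
  ∀ {t d} (ψ : Forms ℤ t d) (i : Fin t) → ExactNormalFormAt ψ i 0 →
  ∃ λ k → DependsOn ψ i k × (∀ j → j ≢ i → ψ j k ≡ 0ℤ)
exactNormalForm₀⇒privateVariable ψ i (J , _ , depᵢ , noDep) =
  J F.zero , depᵢ F.zero , vanish
  where
  vanish : ∀ j → j ≢ i → ψ j (J F.zero) ≡ 0ℤ
  vanish j j≢i with ψ j (J F.zero) ℤ.≟ 0ℤ
  ... | yes ψjk≡0 = ψjk≡0
  ... | no  ψjk≢0 = ⊥-elim (noDep j j≢i (λ { F.zero → ψjk≢0 }))

kernelVector-supportedAt⇒zeroColumn :
  ∀ {r t} (V : Matℤ r t) (y : Fin t → ℤ) (i : Fin t) →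
  InKerℤ V y → y i ≢ 0ℤ → (∀ j → j ≢ i → y j ≡ 0ℤ) → ∀ a → V a i ≡ 0ℤ
kernelVector-supportedAt⇒zeroColumn V y i y∈ker yᵢ≢0 y≡0 a
  with i*j≡0⇒i≡0∨j≡0 (V a i) (trans (sym row-a) (y∈ker a))
  where
  row-a : sumℤ (λ j → V a j * y j) ≡ V a i * y i
  row-a = sumℤ-single _ i (λ j j≢i → trans (cong (V a j *_) (y≡0 j j≢i)) (*-zeroʳ (V a j)))
... | inj₁ Vai≡0 = Vai≡0
... | inj₂ yᵢ≡0  = ⊥-elim (yᵢ≢0 yᵢ≡0)

¬exactNormalForm₀ :
  ∀ {r t d} (V : Matℤ r t) (ψ : Forms ℤ t d) →
  NoZeroColumns V → (∀ x → InKerℤ V (evalℤ ψ x)) →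
  ∀ i → ¬ ExactNormalFormAt ψ i 0
¬exactNormalForm₀ V ψ noZeroCol ψ↦ker i nf₀
  with exactNormalForm₀⇒privateVariable ψ i nf₀
... | k , depᵢ , vanish =
  noZeroCol i (kernelVector-supportedAt⇒zeroColumn V (evalℤ ψ (unit k)) i
    (ψ↦ker (unit k))
    (λ eq → depᵢ (trans (sym (evalℤ-unit ψ k i)) eq))
    (λ j j≢i → trans (evalℤ-unit ψ k j) (vanish j j≢i)))

proposition4p9 : ∀ {r t d} (V : Matℤ r t) (ψ : Forms ℤ t d) →
    VComplexityOne V → NoZeroColumns V → t ≥ 3 →
    IsSurjOntoKerℤ V ψ → NormalForm ψ 1 →
    (i : Fin t) → ExactNormalFormAt ψ i 1
proposition4p9 V ψ _ noZeroCol _ (ψ↦ker , _) nf i with nf i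
... | zero , _ , nf₀ = ⊥-elim (¬exactNormalForm₀ V ψ noZeroCol ψ↦ker i nf₀)
... | suc zero , _ , nf₁ = nf₁
... | suc (suc _) , s≤s () , _
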